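{- In a $\{K_3,K_4\}$-decomposition of $K_{18}$ containing exactly $\alpha=13$ copies of $K_3$, every vertex $x$ satisfies $\alpha_x\in\{1,4\}$.
   Context: A $\{K_3,K_4\}$-decomposition of $K_v$ is a collection of subgraphs of $K_v$, each isomorphic to $K_3$ (triples) or $K_4$ (quadruples), whose edge sets partition $E(K_v)$. $\alpha$ is the number of copies of $K_3$ in the decomposition and, for a vertex $x$, $\alpha_x$ is the number of copies of $K_3$ containing $x$. -}

module Defs where

open import Data.Nat using (ℕ)
open import Data.Fin using (Fin)
open import Data.Fin.Properties using (_≟_)
open import Data.List using (List; length; filter)
open import Data.List.Relation.Unary.All using (All)
open import Data.List.Relation.Unary.Unique.Propositional using (Unique)
open import Data.List.Membership.Propositional using (_∈_)
open import Data.List.Membership.DecPropositional using (_∈?_)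
open import Data.Product using (_×_)
open import Data.Sum using (_⊎_)
open import Relation.Binary.PropositionalEquality using (_≡_; _≢_)
open import Relation.Nullary.Decidable using (_×-dec_)
import Data.Nat as ℕ

IsBlock : {v : ℕ} → List (Fin v) → Set
IsBlock B = Unique B × (length B ≡ 3 ⊎ length B ≡ 4)

edgeCount : {v : ℕ} → Fin v → Fin v → List (List (Fin v)) → ℕ
edgeCount x y bs = length (filter (λ B → (_∈?_ _≟_ x B) ×-dec (_∈?_ _≟_ y B)) bs)

record Decomposition (v : ℕ) : Set where
  field
    blocks    : List (List (Fin v))
    areBlocks : All IsBlock blocks
    partition : (x y : Fin v) → x ≢ y → edgeCount x y blocks ≡ 1

open Decomposition public

α : {v : ℕ} → Decomposition v → ℕ
α D = length (filter (λ B → length B ℕ.≟ 3) (blocks D))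

α[_] : {v : ℕ} → Fin v → Decomposition v → ℕ
α[ x ] D = length (filter (λ B → (length B ℕ.≟ 3) ×-dec (_∈?_ _≟_ x B)) (blocks D))

{-# OPTIONS --safe #-}
-- At a vertex y the blocks through y partition the other 17 vertices, so 2α_y + 3β_y = 17 and
-- α_y ∈ {1, 4, 7}; it remains to exclude α_x = 7.  Then β_x = 1, so x lies in a single quadruple
-- Q, and 13 − 7 = 6 "outer" triples avoid x.  Let c(y) count the outer triples through y.  If
-- y ∈ Q ∖ {x}, the edge xy lies in Q and c(y) = α_y ∈ {1, 4, 7}; if y ∉ Q, it lies in a triple
-- through x and c(y) = α_y − 1 ∈ {0, 3, 6}.  Hence the set H of vertices outside Q that lie on an
-- outer triple satisfies 3|H| ≤ Σ_{y∉Q} c(y) = 18 − Σ_{y∈Q} c(y).  Two points of Q lie in no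
-- other block, so each outer triple has one or no point in Q and the rest in H.  If c(p) ≥ 4 for
-- some p ∈ Q, the outer triples through p reach 2c(p) ≥ 8 distinct points of H, while |H| ≤ 4.
-- Otherwise Σ_{y∈Q} c(y) = 3, so |H| ≤ 5, yet the outer triples cover 3·1 + 3·3 = 12 distinct
-- pairs inside H, more than the 10 available.
module Submission where

open import Defs
open import Data.Fin using (Fin)
open import Data.Sum using (_⊎_; inj₁; inj₂)
open import Relation.Binary.PropositionalEquality using (_≡_)

open import Data.Bool using (if_then_else_)
open import Data.Empty using (⊥; ⊥-elim)
open import Data.Fin using (zero; suc; toℕ; fromℕ<)
open import Data.Fin.Patterns using (0F; 1F; 2F; 3F; 4F; 5F; 6F; 7F; 8F)
open import Data.Fin.Properties using (_≟_; suc-injective; toℕ-fromℕ<; any?)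
open import Data.List using (List; []; _∷_; length; filter; lookup)
import Data.List.Membership.DecPropositional as DecMembership
open import Data.List.Membership.Propositional using (_∈_; _∉_)
open import Data.List.Membership.Propositional.Properties using (∈-lookup)
import Data.List.Relation.Unary.All as All
open import Data.List.Relation.Unary.All.Properties using (All¬⇒¬Any)
open import Data.List.Relation.Unary.Unique.Propositional using (Unique; _∷_)
import Data.Nat as ℕ
open import Data.Nat using (ℕ; zero; suc; _+_; _*_; _≤_; _<_; z≤n; s≤s; _≤?_)
open import Data.Nat.DivMod using (_%_; [m+kn]%n≡m%n)
open import Data.Nat.Properties
  using ( +-identityʳ; +-comm; *-identityʳ; *-zeroʳ; *-comm; *-assoc; *-distribˡ-+; *-distribʳ-+
        ; ≤-refl; ≤-reflexive; ≤-trans; ≤-antisym; ≮⇒≥; n≤0⇒n≡0; m≤m+n; m≤n+m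
        ; +-mono-≤; +-monoˡ-≤; +-monoʳ-≤; *-mono-≤; *-monoˡ-≤; *-monoʳ-≤
        ; +-cancelˡ-≡; +-cancelʳ-≡; +-cancelʳ-≤; *-cancelˡ-≡; *-cancelˡ-≤; *-cancelˡ-<
        ; +-*-semiring; module ≤-Reasoning )
open import Algebra.Properties.Semiring.Sum +-*-semiring
  using (sum; sum-syntax; ∑-distrib-+; ∑-comm; sum-cong-≗; sum-replicate-zero; *-distribˡ-sum; *-distribʳ-sum)
open import Data.Nat.Tactic.RingSolver using (solve-∀)
open import Data.Product using (∃; _×_; _,_; proj₁; proj₂)
open import Relation.Binary.PropositionalEquality using (refl; sym; trans; cong; cong₂; subst; _≢_; module ≡-Reasoning)
open import Relation.Nullary using (Dec; yes; no; does; ¬_; ¬?)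
open import Relation.Nullary.Decidable using (_×-dec_; from-no; decidable-stable)
open import Relation.Unary using (Pred; Decidable)

infix 4 _∈?_
_∈?_ : ∀ {v} (y : Fin v) (B : List (Fin v)) → Dec (y ∈ B)
y ∈? B = DecMembership._∈?_ _≟_ y B

_≢?_ : ∀ {n} (i j : Fin n) → Dec (i ≢ j)
i ≢? j = ¬? (i ≟ j)

𝟙 : ∀ {p} {P : Set p} → Dec P → ℕ
𝟙 d = if does d then 1 else 0

module _ {p} {P : Set p} where

  𝟙≤1 : (d : Dec P) → 𝟙 d ≤ 1
  𝟙≤1 (yes _) = s≤s z≤n
  𝟙≤1 (no _)  = z≤n

  𝟙-yes : P → (d : Dec P) → 𝟙 d ≡ 1
  𝟙-yes _  (yes _)  = refl
  𝟙-yes pr (no ¬pr) = ⊥-elim (¬pr pr)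

  𝟙-no : ¬ P → (d : Dec P) → 𝟙 d ≡ 0
  𝟙-no ¬pr (yes pr) = ⊥-elim (¬pr pr)
  𝟙-no _   (no _)   = refl

  1≤𝟙 : (d : Dec P) → P → 1 ≤ 𝟙 d
  1≤𝟙 d pr = ≤-reflexive (sym (𝟙-yes pr d))

  𝟙¬?+𝟙 : (d : Dec P) → 𝟙 (¬? d) + 𝟙 d ≡ 1
  𝟙¬?+𝟙 (yes _) = refl
  𝟙¬?+𝟙 (no _)  = refl

  𝟙-*-cong : ∀ {m n} (d : Dec P) → (P → m ≡ n) → 𝟙 d * m ≡ 𝟙 d * n
  𝟙-*-cong (yes pr) m≡n = cong (_+ 0) (m≡n pr)
  𝟙-*-cong (no _)   _   = refl

module _ {p q} {P : Set p} {Q : Set q} where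

  𝟙-×-dec : (d : Dec P) (e : Dec Q) → 𝟙 (d ×-dec e) ≡ 𝟙 d * 𝟙 e
  𝟙-×-dec (yes _) (yes _) = refl
  𝟙-×-dec (yes _) (no _)  = refl
  𝟙-×-dec (no _)  _       = refl

  𝟙-split : (d : Dec P) (e : Dec Q) → 𝟙 d ≡ 𝟙 d * 𝟙 e + 𝟙 (d ×-dec ¬? e)
  𝟙-split (yes _) (yes _) = refl
  𝟙-split (yes _) (no _)  = refl
  𝟙-split (no _)  _       = refl

  1≤𝟙*𝟙 : (d : Dec P) (e : Dec Q) → P → Q → 1 ≤ 𝟙 d * 𝟙 e
  1≤𝟙*𝟙 d e pr qr = *-mono-≤ (1≤𝟙 d pr) (1≤𝟙 e qr)

  1≤𝟙*𝟙⇒ : (d : Dec P) (e : Dec Q) → 1 ≤ 𝟙 d * 𝟙 e → P × Q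
  1≤𝟙*𝟙⇒ (yes pr) (yes qr) _ = pr , qr
  1≤𝟙*𝟙⇒ (yes _)  (no _)   ()
  1≤𝟙*𝟙⇒ (no _)   _        ()

n≤1⇒n*n≡n : ∀ {n} → n ≤ 1 → n * n ≡ n
n≤1⇒n*n≡n z≤n       = refl
n≤1⇒n*n≡n (s≤s z≤n) = refl

∑-mono-≤ : ∀ {n} {f g : Fin n → ℕ} → (∀ i → f i ≤ g i) → sum f ≤ sum g
∑-mono-≤ {zero}  _   = z≤n
∑-mono-≤ {suc n} f≤g = +-mono-≤ (f≤g zero) (∑-mono-≤ (λ i → f≤g (suc i)))

term≤∑ : ∀ {n} (f : Fin n → ℕ) i → f i ≤ sum f
term≤∑ f zero    = m≤m+n _ _
term≤∑ f (suc i) = ≤-trans (term≤∑ (λ j → f (suc j)) i) (m≤n+m _ _)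

∑-const-1 : ∀ n → ∑[ i < n ] 1 ≡ n
∑-const-1 zero    = refl
∑-const-1 (suc n) = cong suc (∑-const-1 n)

∑-zero : ∀ {n} {f : Fin n → ℕ} → (∀ i → f i ≡ 0) → sum f ≡ 0
∑-zero {n} f≡0 = trans (sum-cong-≗ f≡0) (sum-replicate-zero n)

∑-positive : ∀ {n} (f : Fin n → ℕ) → 1 ≤ sum f → ∃ λ i → 1 ≤ f i
∑-positive {suc n} f 1≤∑ with f zero in f₀≡
... | suc _ = zero , subst (1 ≤_) (sym f₀≡) (s≤s z≤n)
... | zero  with ∑-positive (λ i → f (suc i)) 1≤∑
...   | i , 1≤fi = suc i , 1≤fi

∑-split-at : ∀ {n} (f : Fin n → ℕ) i → sum f ≡ f i + ∑[ j < n ] (𝟙 (i ≢? j) * f j)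
∑-split-at f zero    = cong (f zero +_) (sum-cong-≗ (λ j → sym (+-identityʳ (f (suc j)))))
∑-split-at f (suc i) = begin
  f zero + sum (λ j → f (suc j))
    ≡⟨ cong (f zero +_) (∑-split-at (λ j → f (suc j)) i) ⟩
  f zero + (f (suc i) + ∑[ j < _ ] (𝟙 (i ≢? j) * f (suc j)))
    ≡⟨ swap (f zero) (f (suc i)) _ ⟩
  f (suc i) + (f zero + 0 + ∑[ j < _ ] (𝟙 (i ≢? j) * f (suc j))) ∎
  where
  open ≡-Reasoning
  swap : ∀ a b c → a + (b + c) ≡ b + (a + 0 + c)
  swap = solve-∀

term+term≤∑ : ∀ {n} (f : Fin n → ℕ) {i j} → i ≢ j → f i + f j ≤ sum f
term+term≤∑ {n} f {i} {j} i≢j = begin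
  f i + f j                            ≡⟨ cong (f i +_) fj≡ ⟨
  f i + 𝟙 (i ≢? j) * f j               ≤⟨ +-monoʳ-≤ (f i) (term≤∑ (λ k → 𝟙 (i ≢? k) * f k) j) ⟩
  f i + ∑[ k < n ] (𝟙 (i ≢? k) * f k)  ≡⟨ ∑-split-at f i ⟨
  sum f                                ∎
  where
  open ≤-Reasoning
  fj≡ : 𝟙 (i ≢? j) * f j ≡ f j
  fj≡ = trans (cong (_* f j) (𝟙-yes i≢j (i ≢? j))) (+-identityʳ (f j))

∑≤1⇒unique : ∀ {n} (f : Fin n → ℕ) → sum f ≤ 1 → ∀ {i j} → 1 ≤ f i → 1 ≤ f j → i ≡ j
∑≤1⇒unique f ∑≤1 {i} {j} 1≤fi 1≤fj with i ≟ j
... | yes i≡j = i≡j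
... | no i≢j  = ⊥-elim (2≰1 (≤-trans (+-mono-≤ 1≤fi 1≤fj) (≤-trans (term+term≤∑ f i≢j) ∑≤1)))
  where
  2≰1 : ¬ (2 ≤ 1)
  2≰1 (s≤s ())

unique⇒∑≤1 : ∀ {n} (f : Fin n → ℕ) → (∀ i → f i ≤ 1) →
             (∀ {i j} → 1 ≤ f i → 1 ≤ f j → i ≡ j) → sum f ≤ 1
unique⇒∑≤1 {zero}  f _   _      = z≤n
unique⇒∑≤1 {suc n} f f≤1 unique with f zero in f₀≡ | f≤1 zero
... | zero  | _       = unique⇒∑≤1 (λ i → f (suc i)) (λ i → f≤1 (suc i))
                                   (λ 1≤fi 1≤fj → suc-injective (unique 1≤fi 1≤fj))
... | suc _ | s≤s z≤n = s≤s (≤-reflexive (∑-zero rest≡0))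
  where
  rest≡0 : ∀ i → f (suc i) ≡ 0
  rest≡0 i = n≤0⇒n≡0 (≮⇒≥ (λ 1≤fi → zero≢suc (unique (≤-reflexive (sym f₀≡)) 1≤fi)))
    where
    zero≢suc : zero ≢ suc i
    zero≢suc ()

∑-𝟙-≟ : ∀ {n} (i : Fin n) → ∑[ j < n ] 𝟙 (j ≟ i) ≡ 1
∑-𝟙-≟ {n} i = begin
  ∑[ j < n ] 𝟙 (j ≟ i)                            ≡⟨ ∑-split-at (λ j → 𝟙 (j ≟ i)) i ⟩
  𝟙 (i ≟ i) + ∑[ j < n ] (𝟙 (i ≢? j) * 𝟙 (j ≟ i))  ≡⟨ cong₂ _+_ (𝟙-yes refl (i ≟ i)) (∑-zero off-diagonal) ⟩
  1                                               ∎
  where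
  open ≡-Reasoning
  off-diagonal : ∀ j → 𝟙 (i ≢? j) * 𝟙 (j ≟ i) ≡ 0
  off-diagonal j = trans (𝟙-*-cong (i ≢? j) (λ i≢j → 𝟙-no (λ j≡i → i≢j (sym j≡i)) (j ≟ i)))
                         (*-zeroʳ (𝟙 (i ≢? j)))

∑-𝟙-≢+1 : ∀ {n} (i : Fin n) → ∑[ j < n ] 𝟙 (i ≢? j) + 1 ≡ n
∑-𝟙-≢+1 {n} i = begin
  ∑[ j < n ] 𝟙 (i ≢? j) + 1        ≡⟨ +-comm _ 1 ⟩
  1 + ∑[ j < n ] 𝟙 (i ≢? j)        ≡⟨ cong (1 +_) (sum-cong-≗ (λ j → *-identityʳ (𝟙 (i ≢? j)))) ⟨
  1 + ∑[ j < n ] (𝟙 (i ≢? j) * 1)  ≡⟨ ∑-split-at (λ _ → 1) i ⟨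
  ∑[ j < n ] 1                     ≡⟨ ∑-const-1 n ⟩
  n                                ∎
  where open ≡-Reasoning

pairs : ∀ {n} → (Fin n → ℕ) → ℕ
pairs {n} s = ∑[ u < n ] (s u * ∑[ v < n ] (𝟙 (u ≢? v) * s v))

pairs+∑≡∑*∑ : ∀ {n} (s : Fin n → ℕ) → (∀ u → s u ≤ 1) → pairs s + sum s ≡ sum s * sum s
pairs+∑≡∑*∑ {n} s s≤1 = begin
  pairs s + sum s                       ≡⟨ ∑-distrib-+ (λ u → s u * others u) s ⟨
  ∑[ u < n ] (s u * others u + s u)     ≡⟨ sum-cong-≗ with-diagonal ⟩
  ∑[ u < n ] (s u * sum s)              ≡⟨ *-distribʳ-sum (sum s) s ⟨
  sum s * sum s                         ∎
  where
  open ≡-Reasoning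
  others : Fin n → ℕ
  others u = ∑[ v < n ] (𝟙 (u ≢? v) * s v)
  with-diagonal : ∀ u → s u * others u + s u ≡ s u * sum s
  with-diagonal u = begin
    s u * others u + s u          ≡⟨ cong (s u * others u +_) (n≤1⇒n*n≡n (s≤1 u)) ⟨
    s u * others u + s u * s u    ≡⟨ +-comm (s u * others u) (s u * s u) ⟩
    s u * s u + s u * others u    ≡⟨ *-distribˡ-+ (s u) (s u) (others u) ⟨
    s u * (s u + others u)        ≡⟨ cong (s u *_) (∑-split-at s u) ⟨
    s u * sum s                   ∎

length-filter≡∑ : ∀ {a p} {A : Set a} {P : Pred A p} (P? : Decidable P) (xs : List A) →
                  length (filter P? xs) ≡ ∑[ k < length xs ] 𝟙 (P? (lookup xs k))
length-filter≡∑ P? []       = refl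
length-filter≡∑ P? (x ∷ xs) with P? x
... | yes _ = cong suc (length-filter≡∑ P? xs)
... | no _  = length-filter≡∑ P? xs

∑-𝟙-∈≡length : ∀ {v} (B : List (Fin v)) → Unique B → ∑[ y < v ] 𝟙 (y ∈? B) ≡ length B
∑-𝟙-∈≡length {v} []      _              = sum-replicate-zero v
∑-𝟙-∈≡length {v} (b ∷ B) (b∉B ∷ unique) = begin
  ∑[ y < v ] 𝟙 (y ∈? b ∷ B)                     ≡⟨ sum-cong-≗ head-or-tail ⟩
  ∑[ y < v ] (𝟙 (y ≟ b) + 𝟙 (y ∈? B))           ≡⟨ ∑-distrib-+ (λ y → 𝟙 (y ≟ b)) (λ y → 𝟙 (y ∈? B)) ⟩
  ∑[ y < v ] 𝟙 (y ≟ b) + ∑[ y < v ] 𝟙 (y ∈? B)  ≡⟨ cong₂ _+_ (∑-𝟙-≟ b) (∑-𝟙-∈≡length B unique) ⟩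
  suc (length B)                                ∎
  where
  open ≡-Reasoning
  head-or-tail : ∀ y → 𝟙 (y ∈? b ∷ B) ≡ 𝟙 (y ≟ b) + 𝟙 (y ∈? B)
  head-or-tail y with y ≟ b
  ... | yes refl = sym (cong suc (𝟙-no (All¬⇒¬Any b∉B) (b ∈? B)))
  ... | no _     = refl

module _ {b n : ℕ} (χ : Fin b → Fin n → ℕ) where

  cover : (Fin b → ℕ) → Fin n → Fin n → ℕ
  cover w u y = ∑[ k < b ] (w k * (χ k u * χ k y))

  star-packing : ∀ w p (g : Fin n → ℕ) → g p ≡ 0 → (∀ y → p ≢ y → cover w p y ≤ 1) →
                 ∑[ k < b ] (w k * (χ k p * ∑[ y < n ] (g y * χ k y))) ≤ sum g
  star-packing w p g g[p]≡0 cover≤1 = begin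
    ∑[ k < b ] (w k * (χ k p * ∑[ y < n ] (g y * χ k y)))
      ≡⟨ sum-cong-≗ expand ⟩
    ∑[ k < b ] ∑[ y < n ] (g y * (w k * (χ k p * χ k y)))
      ≡⟨ ∑-comm (λ k y → g y * (w k * (χ k p * χ k y))) ⟩
    ∑[ y < n ] ∑[ k < b ] (g y * (w k * (χ k p * χ k y)))
      ≡⟨ sum-cong-≗ (λ y → *-distribˡ-sum (g y) (λ k → w k * (χ k p * χ k y))) ⟨
    ∑[ y < n ] (g y * cover w p y)
      ≤⟨ ∑-mono-≤ term≤g ⟩
    sum g ∎
    where
    open ≤-Reasoning
    expand : ∀ k → w k * (χ k p * ∑[ y < n ] (g y * χ k y)) ≡ ∑[ y < n ] (g y * (w k * (χ k p * χ k y)))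
    expand k = begin-equality
      w k * (χ k p * ∑[ y < n ] (g y * χ k y))    ≡⟨ cong (w k *_) (*-distribˡ-sum (χ k p) (λ y → g y * χ k y)) ⟩
      w k * ∑[ y < n ] (χ k p * (g y * χ k y))    ≡⟨ *-distribˡ-sum (w k) (λ y → χ k p * (g y * χ k y)) ⟩
      ∑[ y < n ] (w k * (χ k p * (g y * χ k y)))  ≡⟨ sum-cong-≗ (λ y → reorder (w k) (χ k p) (g y) (χ k y)) ⟩
      ∑[ y < n ] (g y * (w k * (χ k p * χ k y)))  ∎
      where
      reorder : ∀ a c d e → a * (c * (d * e)) ≡ d * (a * (c * e))
      reorder = solve-∀
    term≤g : ∀ y → g y * cover w p y ≤ g y
    term≤g y with p ≟ y
    ... | yes refl = ≤-trans (≤-reflexive (cong (_* cover w p p) g[p]≡0)) z≤n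
    ... | no p≢y   = ≤-trans (*-monoʳ-≤ (g y) (cover≤1 y p≢y)) (≤-reflexive (*-identityʳ (g y)))

  pair-packing : ∀ w (g : Fin n → ℕ) → (∀ u y → u ≢ y → cover w u y ≤ 1) →
                 ∑[ k < b ] (w k * pairs (λ y → g y * χ k y)) ≤ pairs g
  pair-packing w g cover≤1 = begin
    ∑[ k < b ] (w k * pairs (λ y → g y * χ k y))
      ≡⟨ sum-cong-≗ expand ⟩
    ∑[ k < b ] ∑[ u < n ] (g u * star k u)
      ≡⟨ ∑-comm (λ k u → g u * star k u) ⟩
    ∑[ u < n ] ∑[ k < b ] (g u * star k u)
      ≡⟨ sum-cong-≗ (λ u → *-distribˡ-sum (g u) (λ k → star k u)) ⟨
    ∑[ u < n ] (g u * ∑[ k < b ] star k u)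
      ≤⟨ ∑-mono-≤ (λ u → *-monoʳ-≤ (g u) (star-packing w u (g′ u) (g′-diagonal u) (cover≤1 u))) ⟩
    pairs g ∎
    where
    open ≤-Reasoning
    g′ : Fin n → Fin n → ℕ
    g′ u y = 𝟙 (u ≢? y) * g y
    g′-diagonal : ∀ u → g′ u u ≡ 0
    g′-diagonal u = cong (_* g u) (𝟙-no (λ u≢u → u≢u refl) (u ≢? u))
    star : Fin b → Fin n → ℕ
    star k u = w k * (χ k u * ∑[ y < n ] (g′ u y * χ k y))
    expand : ∀ k → w k * pairs (λ y → g y * χ k y) ≡ ∑[ u < n ] (g u * star k u)
    expand k = begin-equality
      w k * pairs (λ y → g y * χ k y)
        ≡⟨ *-distribˡ-sum (w k) (λ u → g u * χ k u * ∑[ y < n ] (𝟙 (u ≢? y) * (g y * χ k y))) ⟩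
      ∑[ u < n ] (w k * (g u * χ k u * ∑[ y < n ] (𝟙 (u ≢? y) * (g y * χ k y))))
        ≡⟨ sum-cong-≗ (λ u → trans (cong (λ s → w k * (g u * χ k u * s)) (regroup u))
                                   (reorder (w k) (g u) (χ k u) (∑[ y < n ] (g′ u y * χ k y)))) ⟩
      ∑[ u < n ] (g u * star k u) ∎
      where
      regroup : ∀ u → ∑[ y < n ] (𝟙 (u ≢? y) * (g y * χ k y)) ≡ ∑[ y < n ] (g′ u y * χ k y)
      regroup u = sum-cong-≗ (λ y → sym (*-assoc (𝟙 (u ≢? y)) (g y) (χ k y)))
      reorder : ∀ a d c s → a * (d * c * s) ≡ d * (a * (c * s))
      reorder = solve-∀

module Incidence {v : ℕ} (D : Decomposition v) where

  b : ℕ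
  b = length (blocks D)

  block : Fin b → List (Fin v)
  block = lookup (blocks D)

  isBlock : ∀ k → IsBlock (block k)
  isBlock k = All.lookup (areBlocks D) (∈-lookup k)

  χ : Fin b → Fin v → ℕ
  χ k y = 𝟙 (y ∈? block k)

  triple? quadruple? : ∀ k → Dec (length (block k) ≡ _)
  triple?    k = length (block k) ℕ.≟ 3
  quadruple? k = length (block k) ℕ.≟ 4

  tri quad : Fin b → ℕ
  tri  k = 𝟙 (triple? k)
  quad k = 𝟙 (quadruple? k)

  β[_] : Fin v → ℕ
  β[ x ] = ∑[ k < b ] (quad k * χ k x)

  α≡∑tri : α D ≡ sum tri
  α≡∑tri = length-filter≡∑ _ (blocks D)

  α[_]≡∑ : ∀ x → α[ x ] D ≡ ∑[ k < b ] 𝟙 (triple? k ×-dec x ∈? block k)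
  α[ x ]≡∑ = length-filter≡∑ _ (blocks D)

  tri+quad≡1 : ∀ k → tri k + quad k ≡ 1
  tri+quad≡1 k with isBlock k
  ... | _ , inj₁ |k|≡3 rewrite |k|≡3 = refl
  ... | _ , inj₂ |k|≡4 rewrite |k|≡4 = refl

  length≡1+2tri+3quad : ∀ k → length (block k) ≡ 1 + (2 * tri k + 3 * quad k)
  length≡1+2tri+3quad k with isBlock k
  ... | _ , inj₁ |k|≡3 rewrite |k|≡3 = refl
  ... | _ , inj₂ |k|≡4 rewrite |k|≡4 = refl

  edge≡1 : ∀ {u y} → u ≢ y → ∑[ k < b ] (χ k u * χ k y) ≡ 1
  edge≡1 {u} {y} u≢y = begin
    ∑[ k < b ] (χ k u * χ k y)
      ≡⟨ sum-cong-≗ (λ k → 𝟙-×-dec (u ∈? block k) (y ∈? block k)) ⟨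
    ∑[ k < b ] 𝟙 (u ∈? block k ×-dec y ∈? block k)
      ≡⟨ length-filter≡∑ _ (blocks D) ⟨
    edgeCount u y (blocks D)
      ≡⟨ partition D u y u≢y ⟩
    1 ∎
    where open ≡-Reasoning

  cover-tri+quad : ∀ u y → cover χ tri u y + cover χ quad u y ≡ ∑[ k < b ] (χ k u * χ k y)
  cover-tri+quad u y = begin
    cover χ tri u y + cover χ quad u y
      ≡⟨ ∑-distrib-+ (λ k → tri k * (χ k u * χ k y)) (λ k → quad k * (χ k u * χ k y)) ⟨
    ∑[ k < b ] (tri k * (χ k u * χ k y) + quad k * (χ k u * χ k y))
      ≡⟨ sum-cong-≗ (λ k → *-distribʳ-+ (χ k u * χ k y) (tri k) (quad k)) ⟨
    ∑[ k < b ] ((tri k + quad k) * (χ k u * χ k y))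
      ≡⟨ sum-cong-≗ (λ k → trans (cong (_* (χ k u * χ k y)) (tri+quad≡1 k)) (+-identityʳ _)) ⟩
    ∑[ k < b ] (χ k u * χ k y) ∎
    where open ≡-Reasoning

  cover≤1 : ∀ w → (∀ k → w k ≤ 1) → ∀ {u y} → u ≢ y → cover χ w u y ≤ 1
  cover≤1 w w≤1 {u} {y} u≢y = begin
    cover χ w u y                     ≤⟨ ∑-mono-≤ (λ k → *-monoˡ-≤ (χ k u * χ k y) (w≤1 k)) ⟩
    ∑[ k < b ] (1 * (χ k u * χ k y))  ≡⟨ sum-cong-≗ (λ k → +-identityʳ (χ k u * χ k y)) ⟩
    ∑[ k < b ] (χ k u * χ k y)        ≡⟨ edge≡1 u≢y ⟩
    1                                 ∎
    where open ≤-Reasoning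

  same-block : ∀ {u y i j} → u ≢ y → u ∈ block i → y ∈ block i → u ∈ block j → y ∈ block j → i ≡ j
  same-block {u} {y} u≢y u∈i y∈i u∈j y∈j =
    ∑≤1⇒unique (λ k → χ k u * χ k y) (≤-reflexive (edge≡1 u≢y)) (both u∈i y∈i) (both u∈j y∈j)
    where
    both : ∀ {k} → u ∈ block k → y ∈ block k → 1 ≤ χ k u * χ k y
    both {k} = 1≤𝟙*𝟙 (u ∈? block k) (y ∈? block k)

  others-in-block : ∀ {x} k → x ∈ block k → ∑[ y < v ] (𝟙 (x ≢? y) * χ k y) ≡ 2 * tri k + 3 * quad k
  others-in-block {x} k x∈k = +-cancelˡ-≡ 1 _ _ (begin
    1 + others                     ≡⟨ cong (_+ others) (𝟙-yes x∈k (x ∈? block k)) ⟨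
    χ k x + others                 ≡⟨ ∑-split-at (χ k) x ⟨
    sum (χ k)                      ≡⟨ ∑-𝟙-∈≡length (block k) (proj₁ (isBlock k)) ⟩
    length (block k)               ≡⟨ length≡1+2tri+3quad k ⟩
    1 + (2 * tri k + 3 * quad k)   ∎)
    where
    open ≡-Reasoning
    others : ℕ
    others = ∑[ y < v ] (𝟙 (x ≢? y) * χ k y)

  degree≡2α+3β : ∀ x → ∑[ y < v ] 𝟙 (x ≢? y) ≡ 2 * ∑[ k < b ] (tri k * χ k x) + 3 * β[ x ]
  degree≡2α+3β x = begin
    ∑[ y < v ] 𝟙 (x ≢? y)
      ≡⟨ sum-cong-≗ (λ y → trans (sym (*-identityʳ (𝟙 (x ≢? y))))
                                 (𝟙-*-cong (x ≢? y) (λ x≢y → sym (edge≡1 x≢y)))) ⟩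
    ∑[ y < v ] (𝟙 (x ≢? y) * ∑[ k < b ] (χ k x * χ k y))
      ≡⟨ sum-cong-≗ (λ y → *-distribˡ-sum (𝟙 (x ≢? y)) (λ k → χ k x * χ k y)) ⟩
    ∑[ y < v ] ∑[ k < b ] (𝟙 (x ≢? y) * (χ k x * χ k y))
      ≡⟨ ∑-comm (λ y k → 𝟙 (x ≢? y) * (χ k x * χ k y)) ⟩
    ∑[ k < b ] ∑[ y < v ] (𝟙 (x ≢? y) * (χ k x * χ k y))
      ≡⟨ sum-cong-≗ (λ k → trans (sum-cong-≗ (λ y → swap (𝟙 (x ≢? y)) (χ k x) (χ k y)))
                                 (sym (*-distribˡ-sum (χ k x) (λ y → 𝟙 (x ≢? y) * χ k y)))) ⟩
    ∑[ k < b ] (χ k x * ∑[ y < v ] (𝟙 (x ≢? y) * χ k y))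
      ≡⟨ sum-cong-≗ (λ k → 𝟙-*-cong (x ∈? block k) (others-in-block k)) ⟩
    ∑[ k < b ] (χ k x * (2 * tri k + 3 * quad k))
      ≡⟨ sum-cong-≗ (λ k → distribute (χ k x) (tri k) (quad k)) ⟩
    ∑[ k < b ] (2 * (tri k * χ k x) + 3 * (quad k * χ k x))
      ≡⟨ ∑-distrib-+ (λ k → 2 * (tri k * χ k x)) (λ k → 3 * (quad k * χ k x)) ⟩
    ∑[ k < b ] (2 * (tri k * χ k x)) + ∑[ k < b ] (3 * (quad k * χ k x))
      ≡⟨ cong₂ _+_ (*-distribˡ-sum 2 (λ k → tri k * χ k x)) (*-distribˡ-sum 3 (λ k → quad k * χ k x)) ⟨
    2 * ∑[ k < b ] (tri k * χ k x) + 3 * β[ x ] ∎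
    where
    open ≡-Reasoning
    swap : ∀ e c d → e * (c * d) ≡ c * (e * d)
    swap = solve-∀
    distribute : ∀ c t q → c * (2 * t + 3 * q) ≡ 2 * (t * c) + 3 * (q * c)
    distribute = solve-∀

  local-degree : ∀ x → 2 * α[ x ] D + 3 * β[ x ] + 1 ≡ v
  local-degree x = begin
    2 * α[ x ] D + 3 * β[ x ] + 1
      ≡⟨ cong (λ a → 2 * a + 3 * β[ x ] + 1) α[ x ]≡∑ ⟩
    2 * ∑[ k < b ] 𝟙 (triple? k ×-dec x ∈? block k) + 3 * β[ x ] + 1
      ≡⟨ cong (λ a → 2 * a + 3 * β[ x ] + 1) (sum-cong-≗ (λ k → 𝟙-×-dec (triple? k) (x ∈? block k))) ⟩
    2 * ∑[ k < b ] (tri k * χ k x) + 3 * β[ x ] + 1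
      ≡⟨ cong (_+ 1) (degree≡2α+3β x) ⟨
    ∑[ y < v ] 𝟙 (x ≢? y) + 1
      ≡⟨ ∑-𝟙-≢+1 x ⟩
    v ∎
    where open ≡-Reasoning

data OneFourSeven : ℕ → Set where
  one   : OneFourSeven 1
  four  : OneFourSeven 4
  seven : OneFourSeven 7

local-degree-18 : ∀ a b → 2 * a + 3 * b + 1 ≡ 18 → OneFourSeven a
local-degree-18 a b eq = subst OneFourSeven (toℕ-fromℕ< a<9) (by-residue (fromℕ< a<9) residue′)
  where
  a<9 : a < 9
  a<9 = *-cancelˡ-< 2 a 9 (≤-trans (≤-reflexive (+-comm 1 (2 * a)))
                                    (≤-trans (+-monoˡ-≤ 1 (m≤m+n (2 * a) (3 * b))) (≤-reflexive eq)))
  residue : (2 * a + 1) % 3 ≡ 0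
  residue = begin
    (2 * a + 1) % 3          ≡⟨ [m+kn]%n≡m%n (2 * a + 1) b 3 ⟨
    (2 * a + 1 + b * 3) % 3  ≡⟨ cong (_% 3) (regroup a b) ⟩
    (2 * a + 3 * b + 1) % 3  ≡⟨ cong (_% 3) eq ⟩
    0                        ∎
    where
    open ≡-Reasoning
    regroup : ∀ a b → 2 * a + 1 + b * 3 ≡ 2 * a + 3 * b + 1
    regroup = solve-∀
  residue′ : (2 * toℕ (fromℕ< a<9) + 1) % 3 ≡ 0
  residue′ = subst (λ n → (2 * n + 1) % 3 ≡ 0) (sym (toℕ-fromℕ< a<9)) residue
  by-residue : (i : Fin 9) → (2 * toℕ i + 1) % 3 ≡ 0 → OneFourSeven (toℕ i)
  by-residue 1F _ = one
  by-residue 4F _ = four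
  by-residue 7F _ = seven
  by-residue 0F ()
  by-residue 2F ()
  by-residue 3F ()
  by-residue 5F ()
  by-residue 6F ()
  by-residue 8F ()

local-degree-18-seven : ∀ b → 2 * 7 + 3 * b + 1 ≡ 18 → b ≡ 1
local-degree-18-seven b eq = *-cancelˡ-≡ b 1 3 (+-cancelʳ-≡ 1 (3 * b) 3 (+-cancelˡ-≡ 14 (3 * b + 1) 4 eq))

OneFourSeven-≢7 : ∀ {n} → OneFourSeven n → n ≢ 7 → n ≡ 1 ⊎ n ≡ 4
OneFourSeven-≢7 one   _   = inj₁ refl
OneFourSeven-≢7 four  _   = inj₂ refl
OneFourSeven-≢7 seven n≢7 = ⊥-elim (n≢7 refl)

OneFourSeven-≢1⇒4≤ : ∀ {n} → OneFourSeven n → n ≢ 1 → 4 ≤ n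
OneFourSeven-≢1⇒4≤ one   n≢1 = ⊥-elim (n≢1 refl)
OneFourSeven-≢1⇒4≤ four  _   = ≤-refl
OneFourSeven-≢1⇒4≤ seven _   = m≤m+n 4 3

OneFourSeven-suc⇒3≤ : ∀ {n} → OneFourSeven (suc n) → 1 ≤ n → 3 ≤ n
OneFourSeven-suc⇒3≤ one   ()
OneFourSeven-suc⇒3≤ four  _ = ≤-refl
OneFourSeven-suc⇒3≤ seven _ = m≤m+n 3 3

pairs-in-triple : ∀ {P n m} → P + n ≡ n * n → m + n ≡ 3 → m ≤ 1 → P + 4 * m ≡ 6
pairs-in-triple {P} {m = zero}     P+3≡9 refl _ = trans (+-identityʳ P) (+-cancelʳ-≡ 3 P 6 P+3≡9)
pairs-in-triple {P} {m = suc zero} P+2≡4 refl _ = cong (_+ 4) (+-cancelʳ-≡ 2 P 2 P+2≡4)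
pairs-in-triple {m = suc (suc _)}  _     _    (s≤s ())

heavy-contradiction : ∀ {n h} → 4 ≤ n → 2 * n ≤ h → 3 * h + n ≤ 18 → ⊥
heavy-contradiction {n} {h} 4≤n 2n≤h 3h+n≤18 = from-no (28 ≤? 18) (begin
  28               ≤⟨ *-monoʳ-≤ 7 4≤n ⟩
  7 * n            ≡⟨ regroup n ⟩
  3 * (2 * n) + n  ≤⟨ +-monoˡ-≤ n (*-monoʳ-≤ 3 2n≤h) ⟩
  3 * h + n        ≤⟨ 3h+n≤18 ⟩
  18               ∎)
  where
  open ≤-Reasoning
  regroup : ∀ n → 7 * n ≡ 3 * (2 * n) + n
  regroup = solve-∀

light-contradiction : ∀ {h P} → 3 * h ≤ 15 → 24 ≤ P → P + h ≡ h * h → ⊥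
light-contradiction {h} {P} 3h≤15 24≤P P+h≡h*h = from-no (24 ≤? 20) (+-cancelʳ-≤ h 24 20 (begin
  24 + h     ≤⟨ +-monoˡ-≤ h 24≤P ⟩
  P + h      ≡⟨ P+h≡h*h ⟩
  h * h      ≤⟨ *-monoˡ-≤ h h≤5 ⟩
  5 * h      ≡⟨ regroup h ⟩
  4 * h + h  ≤⟨ +-monoˡ-≤ h (*-monoʳ-≤ 4 h≤5) ⟩
  20 + h     ∎))
  where
  open ≤-Reasoning
  h≤5 : h ≤ 5
  h≤5 = *-cancelˡ-≤ 3 3h≤15
  regroup : ∀ h → 5 * h ≡ 4 * h + h
  regroup = solve-∀

-- v is kept abstract (18 enters only through admissible): sums over Fin 18 would unfold
-- during type checking and exhaust memory.
module SevenTriplesAt {v} (D : Decomposition v)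
  (admissible : ∀ y → OneFourSeven (α[ y ] D)) (α≡13 : α D ≡ 13)
  {x : Fin v} (α[x]≡7 : α[ x ] D ≡ 7) (β[x]≡1 : Incidence.β[_] D x ≡ 1) where

  open Incidence D

  quadruple-at-x : ∃ λ k → 1 ≤ quad k * χ k x
  quadruple-at-x = ∑-positive (λ k → quad k * χ k x) (≤-reflexive (sym β[x]≡1))

  Q : Fin b
  Q = proj₁ quadruple-at-x

  |Q|≡4 : length (block Q) ≡ 4
  |Q|≡4 = proj₁ (1≤𝟙*𝟙⇒ (quadruple? Q) (x ∈? block Q) (proj₂ quadruple-at-x))

  x∈Q : x ∈ block Q
  x∈Q = proj₂ (1≤𝟙*𝟙⇒ (quadruple? Q) (x ∈? block Q) (proj₂ quadruple-at-x))

  only-quadruple-at-x : ∀ {k} → 1 ≤ quad k * χ k x → k ≡ Q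
  only-quadruple-at-x 1≤ = ∑≤1⇒unique (λ k → quad k * χ k x) (≤-reflexive β[x]≡1) 1≤ (proj₂ quadruple-at-x)

  outer? : ∀ k → Dec (length (block k) ≡ 3 × x ∉ block k)
  outer? k = triple? k ×-dec ¬? (x ∈? block k)

  outer : Fin b → ℕ
  outer k = 𝟙 (outer? k)

  tri≡at-x+outer : ∀ k → tri k ≡ tri k * χ k x + outer k
  tri≡at-x+outer k = 𝟙-split (triple? k) (x ∈? block k)

  ∑outer≡6 : sum outer ≡ 6
  ∑outer≡6 = +-cancelˡ-≡ 7 (sum outer) 6 (begin
    7 + sum outer
      ≡⟨ cong (_+ sum outer) (trans (sym α[x]≡7) α[ x ]≡∑) ⟩
    ∑[ k < b ] 𝟙 (triple? k ×-dec x ∈? block k) + sum outer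
      ≡⟨ cong (_+ sum outer) (sum-cong-≗ (λ k → 𝟙-×-dec (triple? k) (x ∈? block k))) ⟩
    ∑[ k < b ] (tri k * χ k x) + sum outer
      ≡⟨ ∑-distrib-+ (λ k → tri k * χ k x) outer ⟨
    ∑[ k < b ] (tri k * χ k x + outer k)
      ≡⟨ sum-cong-≗ tri≡at-x+outer ⟨
    sum tri
      ≡⟨ trans (sym α≡∑tri) α≡13 ⟩
    13 ∎)
    where open ≡-Reasoning

  outer-cover≤1 : ∀ {u y} → u ≢ y → cover χ outer u y ≤ 1
  outer-cover≤1 = cover≤1 outer (λ k → 𝟙≤1 (outer? k))

  c : Fin v → ℕ
  c y = ∑[ k < b ] (outer k * χ k y)

  ∑c≡18 : sum c ≡ 18
  ∑c≡18 = begin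
    ∑[ y < v ] ∑[ k < b ] (outer k * χ k y)  ≡⟨ ∑-comm (λ y k → outer k * χ k y) ⟩
    ∑[ k < b ] ∑[ y < v ] (outer k * χ k y)  ≡⟨ sum-cong-≗ (λ k → *-distribˡ-sum (outer k) (χ k)) ⟨
    ∑[ k < b ] (outer k * sum (χ k))         ≡⟨ sum-cong-≗ (λ k → 𝟙-*-cong (outer? k) (triple-size k)) ⟩
    ∑[ k < b ] (outer k * 3)                 ≡⟨ *-distribʳ-sum 3 outer ⟨
    sum outer * 3                            ≡⟨ cong (_* 3) ∑outer≡6 ⟩
    18                                       ∎
    where
    open ≡-Reasoning
    triple-size : ∀ k → length (block k) ≡ 3 × x ∉ block k → sum (χ k) ≡ 3
    triple-size k (|k|≡3 , _) = trans (∑-𝟙-∈≡length (block k) (proj₁ (isBlock k))) |k|≡3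

  c[x]≡0 : c x ≡ 0
  c[x]≡0 = ∑-zero (λ k → trans (𝟙-*-cong (outer? k) (λ (_ , x∉k) → 𝟙-no x∉k (x ∈? block k)))
                               (*-zeroʳ (outer k)))

  α[y]≡cover+c : ∀ y → α[ y ] D ≡ cover χ tri x y + c y
  α[y]≡cover+c y = begin
    α[ y ] D
      ≡⟨ α[ y ]≡∑ ⟩
    ∑[ k < b ] 𝟙 (triple? k ×-dec y ∈? block k)
      ≡⟨ sum-cong-≗ split ⟩
    ∑[ k < b ] (tri k * (χ k x * χ k y) + outer k * χ k y)
      ≡⟨ ∑-distrib-+ (λ k → tri k * (χ k x * χ k y)) (λ k → outer k * χ k y) ⟩
    cover χ tri x y + c y ∎
    where
    open ≡-Reasoning
    split : ∀ k → 𝟙 (triple? k ×-dec y ∈? block k) ≡ tri k * (χ k x * χ k y) + outer k * χ k y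
    split k = begin
      𝟙 (triple? k ×-dec y ∈? block k)           ≡⟨ 𝟙-×-dec (triple? k) (y ∈? block k) ⟩
      tri k * χ k y                              ≡⟨ cong (_* χ k y) (tri≡at-x+outer k) ⟩
      (tri k * χ k x + outer k) * χ k y          ≡⟨ *-distribʳ-+ (χ k y) (tri k * χ k x) (outer k) ⟩
      tri k * χ k x * χ k y + outer k * χ k y    ≡⟨ cong (_+ outer k * χ k y) (*-assoc (tri k) (χ k x) (χ k y)) ⟩
      tri k * (χ k x * χ k y) + outer k * χ k y  ∎

  on-Q-admissible : ∀ {y} → y ∈ block Q → y ≢ x → OneFourSeven (c y)
  on-Q-admissible {y} y∈Q y≢x = subst OneFourSeven α[y]≡c (admissible y)
    where
    quadruple-covers : 1 ≤ cover χ quad x y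
    quadruple-covers = ≤-trans
      (*-mono-≤ (1≤𝟙 (quadruple? Q) |Q|≡4) (1≤𝟙*𝟙 (x ∈? block Q) (y ∈? block Q) x∈Q y∈Q))
      (term≤∑ (λ k → quad k * (χ k x * χ k y)) Q)
    no-triple-covers : cover χ tri x y ≡ 0
    no-triple-covers = n≤0⇒n≡0 (+-cancelʳ-≤ 1 (cover χ tri x y) 0 (begin
      cover χ tri x y + 1                 ≤⟨ +-monoʳ-≤ (cover χ tri x y) quadruple-covers ⟩
      cover χ tri x y + cover χ quad x y  ≡⟨ cover-tri+quad x y ⟩
      ∑[ k < b ] (χ k x * χ k y)          ≡⟨ edge≡1 (λ x≡y → y≢x (sym x≡y)) ⟩
      1                                   ∎))
      where open ≤-Reasoning
    α[y]≡c : α[ y ] D ≡ c y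
    α[y]≡c = trans (α[y]≡cover+c y) (cong (_+ c y) no-triple-covers)

  off-Q-admissible : ∀ {y} → y ∉ block Q → OneFourSeven (1 + c y)
  off-Q-admissible {y} y∉Q = subst OneFourSeven α[y]≡1+c (admissible y)
    where
    x≢y : x ≢ y
    x≢y refl = y∉Q x∈Q
    outside-quadruple-at-x : ∀ k → length (block k) ≡ 4 → x ∈ block k → y ∉ block k
    outside-quadruple-at-x k |k|≡4 x∈k =
      subst (λ k → y ∉ block k) (sym (only-quadruple-at-x 1≤quad*χx)) y∉Q
      where
      1≤quad*χx : 1 ≤ quad k * χ k x
      1≤quad*χx = 1≤𝟙*𝟙 (quadruple? k) (x ∈? block k) |k|≡4 x∈k
    no-quadruple-covers : cover χ quad x y ≡ 0
    no-quadruple-covers = ∑-zero λ k →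
      trans (𝟙-*-cong (quadruple? k) (λ |k|≡4 → 𝟙-*-cong (x ∈? block k) (λ x∈k →
               𝟙-no (outside-quadruple-at-x k |k|≡4 x∈k) (y ∈? block k))))
            (trans (cong (quad k *_) (*-zeroʳ (χ k x))) (*-zeroʳ (quad k)))
    triple-covers : cover χ tri x y ≡ 1
    triple-covers = begin
      cover χ tri x y                     ≡⟨ +-identityʳ _ ⟨
      cover χ tri x y + 0                 ≡⟨ cong (cover χ tri x y +_) no-quadruple-covers ⟨
      cover χ tri x y + cover χ quad x y  ≡⟨ cover-tri+quad x y ⟩
      ∑[ k < b ] (χ k x * χ k y)          ≡⟨ edge≡1 x≢y ⟩
      1                                   ∎
      where open ≡-Reasoning
    α[y]≡1+c : α[ y ] D ≡ 1 + c y
    α[y]≡1+c = trans (α[y]≡cover+c y) (cong (_+ c y) triple-covers)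

  onQ offQ : Fin v → ℕ
  onQ  y = 𝟙 (y ∈? block Q)
  offQ y = 𝟙 (¬? (y ∈? block Q))

  ∑c-on-Q ∑c-off-Q : ℕ
  ∑c-on-Q  = ∑[ y < v ] (onQ y * c y)
  ∑c-off-Q = ∑[ y < v ] (offQ y * c y)

  ∑c-off-Q+∑c-on-Q≡18 : ∑c-off-Q + ∑c-on-Q ≡ 18
  ∑c-off-Q+∑c-on-Q≡18 = begin
    ∑c-off-Q + ∑c-on-Q                      ≡⟨ ∑-distrib-+ (λ y → offQ y * c y) (λ y → onQ y * c y) ⟨
    ∑[ y < v ] (offQ y * c y + onQ y * c y)  ≡⟨ sum-cong-≗ (λ y → *-distribʳ-+ (c y) (offQ y) (onQ y)) ⟨
    ∑[ y < v ] ((offQ y + onQ y) * c y)      ≡⟨ sum-cong-≗ (λ y → trans (cong (_* c y) (𝟙¬?+𝟙 (y ∈? block Q)))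
                                                                        (+-identityʳ (c y))) ⟩
    sum c                                    ≡⟨ ∑c≡18 ⟩
    18                                       ∎
    where open ≡-Reasoning

  c≤∑c-on-Q : ∀ {p} → p ∈ block Q → c p ≤ ∑c-on-Q
  c≤∑c-on-Q {p} p∈Q = ≤-trans (≤-reflexive (sym (trans (cong (_* c p) (𝟙-yes p∈Q (p ∈? block Q)))
                                                       (+-identityʳ (c p)))))
                              (term≤∑ (λ y → onQ y * c y) p)

  H? : ∀ y → Dec (y ∉ block Q × 1 ≤ c y)
  H? y = ¬? (y ∈? block Q) ×-dec (1 ≤? c y)

  H : Fin v → ℕ
  H y = 𝟙 (H? y)

  H-on-Q : ∀ {p} → p ∈ block Q → H p ≡ 0
  H-on-Q {p} p∈Q = 𝟙-no (λ (p∉Q , _) → p∉Q p∈Q) (H? p)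

  3*∑H≤∑c-off-Q : 3 * sum H ≤ ∑c-off-Q
  3*∑H≤∑c-off-Q = begin
    3 * sum H             ≡⟨ *-distribˡ-sum 3 H ⟩
    ∑[ y < v ] (3 * H y)  ≤⟨ ∑-mono-≤ (λ y → bound y (H? y)) ⟩
    ∑c-off-Q              ∎
    where
    open ≤-Reasoning
    bound : ∀ y (d : Dec (y ∉ block Q × 1 ≤ c y)) → 3 * 𝟙 d ≤ offQ y * c y
    bound y (no _)             = z≤n
    bound y (yes (y∉Q , 1≤c)) = ≤-trans (OneFourSeven-suc⇒3≤ (off-Q-admissible y∉Q) 1≤c)
      (≤-reflexive (sym (trans (cong (_* c y) (𝟙-yes y∉Q (¬? (y ∈? block Q)))) (+-identityʳ (c y)))))

  meetQ meetH : Fin b → ℕ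
  meetQ k = ∑[ y < v ] (onQ y * χ k y)
  meetH k = ∑[ y < v ] (H y * χ k y)

  outer-meets-Q-once : ∀ k → length (block k) ≡ 3 → meetQ k ≤ 1
  outer-meets-Q-once k |k|≡3 = unique⇒∑≤1 (λ y → onQ y * χ k y) bit unique
    where
    bit : ∀ y → onQ y * χ k y ≤ 1
    bit y = *-mono-≤ (𝟙≤1 (y ∈? block Q)) (𝟙≤1 (y ∈? block k))
    in-both : ∀ {y} → 1 ≤ onQ y * χ k y → y ∈ block Q × y ∈ block k
    in-both {y} = 1≤𝟙*𝟙⇒ (y ∈? block Q) (y ∈? block k)
    unique : ∀ {u w} → 1 ≤ onQ u * χ k u → 1 ≤ onQ w * χ k w → u ≡ w
    unique {u} {w} 1≤u 1≤w with u ≟ w | in-both 1≤u | in-both 1≤w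
    ... | yes u≡w | _         | _         = u≡w
    ... | no u≢w  | u∈Q , u∈k | w∈Q , w∈k = ⊥-elim (3≢4 (begin
      3                 ≡⟨ |k|≡3 ⟨
      length (block k)  ≡⟨ cong (λ j → length (block j)) (same-block u≢w u∈k w∈k u∈Q w∈Q) ⟩
      length (block Q)  ≡⟨ |Q|≡4 ⟩
      4                 ∎))
      where
      open ≡-Reasoning
      3≢4 : 3 ≢ 4
      3≢4 ()

  outer-size : ∀ k → length (block k) ≡ 3 → x ∉ block k → meetQ k + meetH k ≡ 3
  outer-size k |k|≡3 x∉k = begin
    meetQ k + meetH k                              ≡⟨ ∑-distrib-+ (λ y → onQ y * χ k y) (λ y → H y * χ k y) ⟨
    ∑[ y < v ] (onQ y * χ k y + H y * χ k y)       ≡⟨ sum-cong-≗ (λ y → *-distribʳ-+ (χ k y) (onQ y) (H y)) ⟨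
    ∑[ y < v ] ((onQ y + H y) * χ k y)             ≡⟨ sum-cong-≗ on-or-off ⟩
    sum (χ k)                                      ≡⟨ ∑-𝟙-∈≡length (block k) (proj₁ (isBlock k)) ⟩
    length (block k)                               ≡⟨ |k|≡3 ⟩
    3                                              ∎
    where
    open ≡-Reasoning
    H≡offQ : ∀ {y} → y ∈ block k → H y ≡ offQ y
    H≡offQ {y} y∈k = begin
      H y                       ≡⟨ 𝟙-×-dec (¬? (y ∈? block Q)) (1 ≤? c y) ⟩
      offQ y * 𝟙 (1 ≤? c y)     ≡⟨ cong (offQ y *_) (𝟙-yes 1≤c (1 ≤? c y)) ⟩
      offQ y * 1                ≡⟨ *-identityʳ (offQ y) ⟩
      offQ y                    ∎
      where
      1≤c : 1 ≤ c y
      1≤c = ≤-trans (1≤𝟙*𝟙 (outer? k) (y ∈? block k) (|k|≡3 , x∉k) y∈k)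
                    (term≤∑ (λ j → outer j * χ j y) k)
    on-or-off : ∀ y → (onQ y + H y) * χ k y ≡ χ k y
    on-or-off y = begin
      (onQ y + H y) * χ k y     ≡⟨ *-comm (onQ y + H y) (χ k y) ⟩
      χ k y * (onQ y + H y)     ≡⟨ 𝟙-*-cong (y ∈? block k) (λ y∈k → cong (onQ y +_) (H≡offQ y∈k)) ⟩
      χ k y * (onQ y + offQ y)  ≡⟨ cong (χ k y *_) (trans (+-comm (onQ y) (offQ y)) (𝟙¬?+𝟙 (y ∈? block Q))) ⟩
      χ k y * 1                 ≡⟨ *-identityʳ (χ k y) ⟩
      χ k y                     ∎

  meetH≡2 : ∀ {p} k → p ∈ block Q → p ∈ block k → length (block k) ≡ 3 → x ∉ block k → meetH k ≡ 2
  meetH≡2 {p} k p∈Q p∈k |k|≡3 x∉k =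
    +-cancelˡ-≡ 1 (meetH k) 2 (trans (cong (_+ meetH k) (sym meetQ≡1)) (outer-size k |k|≡3 x∉k))
    where
    meetQ≡1 : meetQ k ≡ 1
    meetQ≡1 = ≤-antisym (outer-meets-Q-once k |k|≡3)
                        (≤-trans (1≤𝟙*𝟙 (p ∈? block Q) (p ∈? block k) p∈Q p∈k)
                                 (term≤∑ (λ y → onQ y * χ k y) p))

  2c≤∑H : ∀ {p} → p ∈ block Q → 2 * c p ≤ sum H
  2c≤∑H {p} p∈Q = begin
    2 * c p                                   ≡⟨ *-distribˡ-sum 2 (λ k → outer k * χ k p) ⟩
    ∑[ k < b ] (2 * (outer k * χ k p))        ≡⟨ sum-cong-≗ through-p ⟩
    ∑[ k < b ] (outer k * (χ k p * meetH k))  ≤⟨ star-packing χ outer p H (H-on-Q p∈Q) (λ _ → outer-cover≤1) ⟩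
    sum H                                     ∎
    where
    open ≤-Reasoning
    through-p : ∀ k → 2 * (outer k * χ k p) ≡ outer k * (χ k p * meetH k)
    through-p k = trans (reorder (outer k) (χ k p)) (𝟙-*-cong (outer? k) (λ (|k|≡3 , x∉k) →
                    𝟙-*-cong (p ∈? block k) (λ p∈k → sym (meetH≡2 k p∈Q p∈k |k|≡3 x∉k))))
      where
      reorder : ∀ o χp → 2 * (o * χp) ≡ o * (χp * 2)
      reorder = solve-∀

  no-heavy-Q-vertex : ∀ {p} → p ∈ block Q → p ≢ x → c p ≢ 1 → ⊥
  no-heavy-Q-vertex {p} p∈Q p≢x c[p]≢1 = heavy-contradiction
    (OneFourSeven-≢1⇒4≤ (on-Q-admissible p∈Q p≢x) c[p]≢1)
    (2c≤∑H p∈Q)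
    (≤-trans (+-mono-≤ 3*∑H≤∑c-off-Q (c≤∑c-on-Q p∈Q)) (≤-reflexive ∑c-off-Q+∑c-on-Q≡18))

  ∑outer*meetQ≡∑c-on-Q : ∑[ k < b ] (outer k * meetQ k) ≡ ∑c-on-Q
  ∑outer*meetQ≡∑c-on-Q = begin
    ∑[ k < b ] (outer k * meetQ k)
      ≡⟨ sum-cong-≗ (λ k → *-distribˡ-sum (outer k) (λ y → onQ y * χ k y)) ⟩
    ∑[ k < b ] ∑[ y < v ] (outer k * (onQ y * χ k y))
      ≡⟨ ∑-comm (λ k y → outer k * (onQ y * χ k y)) ⟩
    ∑[ y < v ] ∑[ k < b ] (outer k * (onQ y * χ k y))
      ≡⟨ sum-cong-≗ (λ y → trans (sum-cong-≗ (λ k → swap (outer k) (onQ y) (χ k y)))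
                                 (sym (*-distribˡ-sum (onQ y) (λ k → outer k * χ k y)))) ⟩
    ∑c-on-Q ∎
    where
    open ≡-Reasoning
    swap : ∀ o q χy → o * (q * χy) ≡ q * (o * χy)
    swap = solve-∀

  pairs-in-outer : ∀ k → outer k * (pairs (λ y → H y * χ k y) + 4 * meetQ k) ≡ outer k * 6
  pairs-in-outer k = 𝟙-*-cong (outer? k) (λ (|k|≡3 , x∉k) →
    pairs-in-triple (pairs+∑≡∑*∑ (λ y → H y * χ k y) (λ y → *-mono-≤ (𝟙≤1 (H? y)) (𝟙≤1 (y ∈? block k))))
                    (outer-size k |k|≡3 x∉k)
                    (outer-meets-Q-once k |k|≡3))

  ∑pairs-in-outer : ℕ
  ∑pairs-in-outer = ∑[ k < b ] (outer k * pairs (λ y → H y * χ k y))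

  ∑pairs-in-outer+4∑c-on-Q≡36 : ∑pairs-in-outer + 4 * ∑c-on-Q ≡ 36
  ∑pairs-in-outer+4∑c-on-Q≡36 = begin
    ∑pairs-in-outer + 4 * ∑c-on-Q
      ≡⟨ cong (λ t → ∑[ k < b ] P k + 4 * t) ∑outer*meetQ≡∑c-on-Q ⟨
    ∑[ k < b ] P k + 4 * ∑[ k < b ] (outer k * meetQ k)
      ≡⟨ cong (∑[ k < b ] P k +_) (*-distribˡ-sum 4 (λ k → outer k * meetQ k)) ⟩
    ∑[ k < b ] P k + ∑[ k < b ] (4 * (outer k * meetQ k))
      ≡⟨ ∑-distrib-+ P (λ k → 4 * (outer k * meetQ k)) ⟨
    ∑[ k < b ] (P k + 4 * (outer k * meetQ k))
      ≡⟨ sum-cong-≗ (λ k → factor (outer k) (pairs (λ y → H y * χ k y)) (meetQ k)) ⟩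
    ∑[ k < b ] (outer k * (pairs (λ y → H y * χ k y) + 4 * meetQ k))
      ≡⟨ sum-cong-≗ pairs-in-outer ⟩
    ∑[ k < b ] (outer k * 6)
      ≡⟨ *-distribʳ-sum 6 outer ⟨
    sum outer * 6
      ≡⟨ cong (_* 6) ∑outer≡6 ⟩
    36 ∎
    where
    open ≡-Reasoning
    P : Fin b → ℕ
    P k = outer k * pairs (λ y → H y * χ k y)
    factor : ∀ o p m → o * p + 4 * (o * m) ≡ o * (p + 4 * m)
    factor = solve-∀

  ∑c-on-Q≡3 : (∀ {p} → p ∈ block Q → p ≢ x → c p ≡ 1) → ∑c-on-Q ≡ 3
  ∑c-on-Q≡3 light = begin
    ∑[ y < v ] (onQ y * c y)            ≡⟨ sum-cong-≗ (λ y → trans (𝟙-*-cong (y ∈? block Q) c≡[x≢y])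
                                                                  (*-comm (χ Q y) (𝟙 (x ≢? y)))) ⟩
    ∑[ y < v ] (𝟙 (x ≢? y) * χ Q y)     ≡⟨ others-in-block Q x∈Q ⟩
    2 * tri Q + 3 * quad Q              ≡⟨ cong₂ (λ t q → 2 * t + 3 * q) (𝟙-no |Q|≢3 (triple? Q))
                                                                         (𝟙-yes |Q|≡4 (quadruple? Q)) ⟩
    3                                   ∎
    where
    open ≡-Reasoning
    c≡[x≢y] : ∀ {y} → y ∈ block Q → c y ≡ 𝟙 (x ≢? y)
    c≡[x≢y] {y} y∈Q with x ≟ y
    ... | yes refl = c[x]≡0
    ... | no x≢y   = light y∈Q (λ y≡x → x≢y (sym y≡x))
    |Q|≢3 : length (block Q) ≢ 3
    |Q|≢3 |Q|≡3 with trans (sym |Q|≡3) |Q|≡4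
    ... | ()

  all-Q-vertices-light : (∀ {p} → p ∈ block Q → p ≢ x → c p ≡ 1) → ⊥
  all-Q-vertices-light light =
    light-contradiction 3*∑H≤15 24≤pairs[H] (pairs+∑≡∑*∑ H (λ y → 𝟙≤1 (H? y)))
    where
    3*∑H≤15 : 3 * sum H ≤ 15
    3*∑H≤15 = ≤-trans 3*∑H≤∑c-off-Q (≤-reflexive (+-cancelʳ-≡ 3 ∑c-off-Q 15
                (trans (cong (∑c-off-Q +_) (sym (∑c-on-Q≡3 light))) ∑c-off-Q+∑c-on-Q≡18)))
    24≤pairs[H] : 24 ≤ pairs H
    24≤pairs[H] = ≤-trans (≤-reflexive (sym ∑pairs-in-outer≡24))
                          (pair-packing χ outer H (λ _ _ → outer-cover≤1))
      where
      ∑pairs-in-outer≡24 : ∑pairs-in-outer ≡ 24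
      ∑pairs-in-outer≡24 = +-cancelʳ-≡ 12 ∑pairs-in-outer 24
        (trans (cong (λ t → ∑pairs-in-outer + 4 * t) (sym (∑c-on-Q≡3 light))) ∑pairs-in-outer+4∑c-on-Q≡36)

  impossible : ⊥
  impossible with any? (λ p → p ∈? block Q ×-dec p ≢? x ×-dec ¬? (c p ℕ.≟ 1))
  ... | yes (p , p∈Q , p≢x , c[p]≢1) = no-heavy-Q-vertex p∈Q p≢x c[p]≢1
  ... | no ∄heavy = all-Q-vertices-light (λ {p} p∈Q p≢x →
                      decidable-stable (c p ℕ.≟ 1) (λ c[p]≢1 → ∄heavy (p , p∈Q , p≢x , c[p]≢1)))

lemma16 : (D : Decomposition 18) → α D ≡ 13 →
          (x : Fin 18) → α[ x ] D ≡ 1 ⊎ α[ x ] D ≡ 4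
lemma16 D α≡13 x = OneFourSeven-≢7 (admissible x) (λ α[x]≡7 →
  SevenTriplesAt.impossible D admissible α≡13 α[x]≡7 (β[x]≡1 α[x]≡7))
  where
  open Incidence D
  admissible : ∀ y → OneFourSeven (α[ y ] D)
  admissible y = local-degree-18 (α[ y ] D) β[ y ] (local-degree y)
  β[x]≡1 : α[ x ] D ≡ 7 → β[ x ] ≡ 1
  β[x]≡1 α[x]≡7 =
    local-degree-18-seven β[ x ] (subst (λ a → 2 * a + 3 * β[ x ] + 1 ≡ 18) α[x]≡7 (local-degree x))
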